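{- Let $G$ be the auxiliary DAG of a $\delta$ALWDR instance (as described in the context) and consider the linear program $$\max \sum_{e\in E(G)} w(e)x_e\quad\text{s.t.}\quad \sum_{e\in E_{d_i}}x_e\le 1\ \ \forall i,\qquad \sum_{e\in\delta^+(v)}x_e-\sum_{e\in\delta^-(v)}x_e=\begin{cases}0 & v\in V(G)\setminus\{s,t\}\\ \delta & v=s\end{cases},\qquad 0\le x_e\le 1\ \ \forall e\in E(G),$$ where $\delta^+(v)$ and $\delta^-(v)$ denote the sets of edges leaving and entering $v$. If $|E_{d_i}|=1$ for every data item $d_i$, then every basic optimum solution of this linear program is integral, i.e. $x_e\in\{0,1\}$ for every edge $e$.
   Context: A $\delta$ALWDR instance: data items $d_1,\dots,d_n$ with nonnegative weights $w_1,\dots,w_n$, $m$ channels, $T$ consecutive time slots; in each (channel, time slot) pair at most one item is broadcast, and an item may occur in several pairs. The auxiliary DAG $G$: for every occurrence of item $d_i$ in channel $j$ at time slot $k$ there is an edge $e_{i,j,k}=(v_{i,j,k},w_{i,j,k})$ of weight $w(e_{i,j,k})=w_i$; $E_{d_i}$ is the set of all edges $e_{i,j,k}$ of item $d_i$. In addition there are weight-$0$ edges $(w_{i,j,k},v_{i',j',k'})$ whenever the occurrence $(i',j',k')$ can be retrieved after $(i,j,k)$ by one antenna, i.e. whenever $j'=j$ and $k'>k$, or $k'\ge k+2$; and there are two extra vertices $s,t$ with weight-$0$ edges $(s,v_{i,j,k})$ and $(w_{i,j,k},t)$ for every occurrence. A basic solution of a linear program is a vertex (extreme point) of its feasible pol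ytope.
   Formalization: The weights $w_1,\dots,w_n$ and the variables $x_e$ take rational values, and basic and optimum solutions are judged against rational feasible points. -}

module Defs where

open import Data.Bool using (Bool; true; false; T; _∧_; _∨_; if_then_else_)
open import Data.Nat as ℕ using (ℕ; _<ᵇ_)
open import Data.Fin using (Fin; toℕ)
open import Data.Fin.Properties using () renaming (_≟_ to _≟F_)
open import Data.Integer using (+_)
open import Data.List using (List; []; _∷_; map; _++_; foldr; cartesianProduct; allFin)
open import Data.Maybe using (Maybe; just; nothing; is-just)
open import Data.Product using (Σ; _×_; _,_; proj₁; proj₂; uncurry)
open import Data.Rational using (ℚ; 0ℚ; 1ℚ; _+_; _*_; _-_; _≤_; _<_; _/_)
open import Data.Sum using (_⊎_)
open import Data.Unit using (tt)
open import Relation.Nullary using (¬_)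
open import Relation.Nullary.Decidable using (⌊_⌋)
open import Relation.Binary.PropositionalEquality using (_≡_)

-- A δALWDR instance: n data items with nonnegative (rational) weights,
-- m channels, T time slots; sched j k = the item broadcast in channel j at
-- time slot k (nothing = pair unused).
record Instance : Set where
  field
    n m nT  : ℕ
    weight  : Fin n → ℚ
    weight≥0 : ∀ i → 0ℚ ≤ weight i
    sched   : Fin m → Fin nT → Maybe (Fin n)

module _ (I : Instance) where
  open Instance I

  Slot : Set
  Slot = Fin m × Fin nT

  slots : List Slot
  slots = cartesianProduct (allFin m) (allFin nT)

  schedAt : Slot → Maybe (Fin n)
  schedAt (j , k) = sched j k

  occupied : Slot → Bool
  occupied p = is-just (schedAt p)

  eqSlot : Slot → Slot → Bool
  eqSlot (j , k) (j' , k') = ⌊ j ≟F j' ⌋ ∧ ⌊ k ≟F k' ⌋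

  -- occurrence at p' can be retrieved after occurrence at p by one antenna:
  -- (same channel and k' > k) or k' ≥ k + 2
  compatible : Slot → Slot → Bool
  compatible (j , k) (j' , k') =
    (⌊ j ≟F j' ⌋ ∧ (toℕ k <ᵇ toℕ k')) ∨ (ℕ.suc (toℕ k) <ᵇ toℕ k')

  data Vertex : Set where
    s t : Vertex
    vv  : Slot → Vertex
    ww  : Slot → Vertex

  eqV : Vertex → Vertex → Bool
  eqV s s = true
  eqV t t = true
  eqV (vv p) (vv q) = eqSlot p q
  eqV (ww p) (ww q) = eqSlot p q
  eqV _ _ = false

  data RawEdge : Set where
    itemR  : Slot → RawEdge
    srcR   : Slot → RawEdge
    snkR   : Slot → RawEdge
    transR : Slot → Slot → RawEdge

  isEdge : RawEdge → Bool
  isEdge (itemR p) = occupied p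
  isEdge (srcR p) = occupied p
  isEdge (snkR p) = occupied p
  isEdge (transR p q) = occupied p ∧ occupied q ∧ compatible p q

  Edge : Set
  Edge = Σ RawEdge (λ r → T (isEdge r))

  tailR headR : RawEdge → Vertex
  tailR (itemR p) = vv p
  tailR (srcR p) = s
  tailR (snkR p) = ww p
  tailR (transR p q) = ww p
  headR (itemR p) = ww p
  headR (srcR p) = vv p
  headR (snkR p) = t
  headR (transR p q) = vv q

  tail head : Edge → Vertex
  tail e = tailR (proj₁ e)
  head e = headR (proj₁ e)

  itemOf : Edge → Maybe (Fin n)
  itemOf (itemR p , _) = schedAt p
  itemOf _ = nothing

  eqItem : Maybe (Fin n) → Fin n → Bool
  eqItem (just i') i = ⌊ i' ≟F i ⌋
  eqItem nothing i = false

  w : Edge → ℚ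
  w e with itemOf e
  ... | just i = weight i
  ... | nothing = 0ℚ

  rawEdges : List RawEdge
  rawEdges = map itemR slots ++ map srcR slots ++ map snkR slots
             ++ map (uncurry transR) (cartesianProduct slots slots)

  guardQ : (b : Bool) → (T b → ℚ) → ℚ
  guardQ true f = f tt
  guardQ false f = 0ℚ

  guardN : (b : Bool) → (T b → ℕ) → ℕ
  guardN true f = f tt
  guardN false f = 0

  sumQ : List ℚ → ℚ
  sumQ = foldr _+_ 0ℚ

  -- Σ_{e ∈ E(G)} f e   (every edge of G occurs exactly once in rawEdges)
  ΣE : (Edge → ℚ) → ℚ
  ΣE f = sumQ (map (λ r → guardQ (isEdge r) (λ pr → f (r , pr))) rawEdges)

  countE : (Edge → Bool) → ℕ
  countE P = foldr ℕ._+_ 0 (map (λ r → guardN (isEdge r) (λ pr → if P (r , pr) then 1 else 0)) rawEdges)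

  sizeE-item : Fin n → ℕ
  sizeE-item i = countE (λ e → eqItem (itemOf e) i)

  module _ (x : Edge → ℚ) where
    itemLoad : Fin n → ℚ
    itemLoad i = ΣE (λ e → if eqItem (itemOf e) i then x e else 0ℚ)

    outFlow inFlow : Vertex → ℚ
    outFlow v = ΣE (λ e → if eqV (tail e) v then x e else 0ℚ)
    inFlow v = ΣE (λ e → if eqV (head e) v then x e else 0ℚ)

    objective : ℚ
    objective = ΣE (λ e → w e * x e)

  natQ : ℕ → ℚ
  natQ k = (+ k) / 1

  record Feasible (δ : ℕ) (x : Edge → ℚ) : Set where
    field
      itemCap : ∀ i → itemLoad x i ≤ 1ℚ
      conserv : ∀ v → ¬ (v ≡ s) → ¬ (v ≡ t) → outFlow x v - inFlow x v ≡ 0ℚ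
      source  : outFlow x s - inFlow x s ≡ natQ δ
      lower   : ∀ e → 0ℚ ≤ x e
      upper   : ∀ e → x e ≤ 1ℚ

  Optimal : ℕ → (Edge → ℚ) → Set
  Optimal δ x = Feasible δ x × (∀ y → Feasible δ y → objective y ≤ objective x)

  -- basic solution = vertex (extreme point) of the feasible polytope
  Basic : ℕ → (Edge → ℚ) → Set
  Basic δ x = Feasible δ x ×
    (∀ y z (λ' : ℚ) → Feasible δ y → Feasible δ z → 0ℚ < λ' → λ' < 1ℚ →
       (∀ e → x e ≡ λ' * y e + (1ℚ - λ') * z e) → ∀ e → y e ≡ z e)

  Integral : (Edge → ℚ) → Set
  Integral x = ∀ e → x e ≡ 0ℚ ⊎ x e ≡ 1ℚ

module Submission where

-- Let x be a basic feasible solution and call an edge fractional if 0 < x_e < 1.  At a vertex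
-- other than t the net outflow is 0 or δ, and each non-fractional edge contributes an integer
-- to it, so a fractional edge at such a vertex is never alone there.  Walking from fractional
-- edge to fractional edge (starting at t if t touches one, so that the walk never gets stuck
-- at t) must revisit a vertex, which closes an undirected cycle of fractional edges whose last
-- edge is used only once.  Sending ±ε around it keeps flow conservation and, for ε small,
-- 0 ≤ x ≤ 1; as every item owns a single edge, the item constraints follow from x ≤ 1.  So x
-- is the midpoint of two distinct feasible solutions and not a vertex of the polytope.

open import Defs

open import Data.Bool using (Bool; true; false; T; if_then_else_)
open import Data.Bool.Properties using (T-∧; T-irrelevant)
open import Data.Empty using (⊥-elim)
open import Data.Fin using (Fin)
open import Data.Fin.Properties using () renaming (_≟_ to _≟F_)
open import Data.Integer as ℤ using (ℤ)
import Data.Integer.Properties as ℤ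
open import Data.List using (List; []; _∷_; _++_; [_]; map; foldr; length)
open import Data.List.Properties using (map-∘)
import Data.List.Membership.DecPropositional as DecMembership
open import Data.List.Membership.Propositional using (_∈_; lose)
open import Data.List.Membership.Propositional.Properties
  using (∈-map⁺; ∈-map⁻; ∈-++⁺ˡ; ∈-++⁺ʳ; ∈-++⁻; ∈-cartesianProduct⁺; ∈-allFin)
open import Data.List.Relation.Binary.Disjoint.Propositional using (Disjoint)
open import Data.List.Relation.Unary.All as All using (All; []; _∷_)
import Data.List.Relation.Unary.All.Properties as All
open import Data.List.Relation.Unary.Any using (Any; here; there; any?; satisfied)
open import Data.List.Relation.Unary.Unique.Propositional using (Unique; []; _∷_)
import Data.List.Relation.Unary.Unique.Propositional.Properties as Unique
open import Data.Nat as ℕ using (ℕ; suc)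
import Data.Nat.Properties as ℕ
import Data.Nat.Coprimality as Coprime
open import Data.Nat.ListAction using (sum)
open import Data.Product using (Σ; Σ-syntax; ∃; ∃-syntax; _×_; _,_; proj₁; proj₂; uncurry)
import Data.Product.Properties as ×
open import Data.Rational using (ℚ; 0ℚ; 1ℚ; ½; mkℚ; _+_; _*_; _-_; -_; _≤_; _<_; _⊓_; 1/_;
  NonNegative; Positive; NonZero; nonNegative; positive)
open import Data.Rational.Properties
open import Data.Rational.Solver using (module +-*-Solver)
open import Data.Sum as Sum using (_⊎_; inj₁; inj₂)
import Data.Sum.Properties as ⊎
open import Function using (_∘_)
open import Function.Bundles using (Equivalence)
open import Relation.Binary.Definitions using (DecidableEquality)
open import Relation.Binary.PropositionalEquality hiding ([_])
open import Relation.Nullary using (¬_; ¬?; Dec; yes; no; does; _because_; _⊎-dec_; _×-dec_)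
open import Relation.Nullary.Decidable using (⌊_⌋; map′; toWitness; fromWitness; from-yes)
open import Relation.Nullary.Reflects using (fromEquivalence)

open +-*-Solver

module _ {A B : Set} {p q : B} where

  if-yes : (d : Dec A) → A → (if does d then p else q) ≡ p
  if-yes (yes _) _ = refl
  if-yes (no ¬a) a = ⊥-elim (¬a a)

  if-no : (d : Dec A) → ¬ A → (if does d then p else q) ≡ q
  if-no (yes a) ¬a = ⊥-elim (¬a a)
  if-no (no _)  _  = refl

if-cases : {B : Set} {p q : B} → ∀ b → (if b then p else q) ≡ p ⊎ (if b then p else q) ≡ q
if-cases true  = inj₁ refl
if-cases false = inj₂ refl

disjoint-map : {A B C : Set} {f : A → C} {g : B → C} {xs : List A} {ys : List B} →
  (∀ a b → f a ≢ g b) → Disjoint (map f xs) (map g ys)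
disjoint-map f≢g (fx∈ , gy∈) with ∈-map⁻ _ fx∈ | ∈-map⁻ _ gy∈
... | a , _ , refl | b , _ , eq = f≢g a b eq

disjoint-++ : {A : Set} {xs ys zs : List A} → Disjoint xs ys → Disjoint xs zs → Disjoint xs (ys ++ zs)
disjoint-++ {ys = ys} xs#ys xs#zs (x∈xs , x∈ys++zs) with ∈-++⁻ ys x∈ys++zs
... | inj₁ x∈ys = xs#ys (x∈xs , x∈ys)
... | inj₂ x∈zs = xs#zs (x∈xs , x∈zs)

≡-dec-via-retraction : {A B : Set} (f : A → B) (g : B → A) → (∀ a → g (f a) ≡ a) →
  DecidableEquality B → DecidableEquality A
≡-dec-via-retraction f g gf _≟_ a a' =
  map′ (λ eq → trans (sym (gf a)) (trans (cong g eq) (gf a'))) (cong f) (f a ≟ f a')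

∑ : {A : Set} → List A → (A → ℚ) → ℚ
∑ xs f = foldr _+_ 0ℚ (map f xs)

module _ {A : Set} where

  ∑-linear : ∀ xs {f g h : A → ℚ} a c → (∀ x → f x ≡ a * g x + c * h x) →
    ∑ xs f ≡ a * ∑ xs g + c * ∑ xs h
  ∑-linear [] a c _ = solve 2 (λ a c → con 0ℚ := a :* con 0ℚ :+ c :* con 0ℚ) refl a c
  ∑-linear (x ∷ xs) {f} {g} {h} a c f≡ = begin
    f x + ∑ xs f                              ≡⟨ cong₂ _+_ (f≡ x) (∑-linear xs a c f≡) ⟩
    (a * g x + c * h x) + (a * ∑ xs g + c * ∑ xs h)
      ≡⟨ solve 6 (λ a c G H SG SH → (a :* G :+ c :* H) :+ (a :* SG :+ c :* SH)
                                  := a :* (G :+ SG) :+ c :* (H :+ SH))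
                 refl a c (g x) (h x) (∑ xs g) (∑ xs h) ⟩
    a * ∑ (x ∷ xs) g + c * ∑ (x ∷ xs) h       ∎
    where open ≡-Reasoning

  ∑-++ : ∀ xs {ys} {f : A → ℚ} → ∑ (xs ++ ys) f ≡ ∑ xs f + ∑ ys f
  ∑-++ []       {ys} {f} = sym (+-identityˡ (∑ ys f))
  ∑-++ (x ∷ xs) {ys} {f} = trans (cong (f x +_) (∑-++ xs)) (sym (+-assoc (f x) (∑ xs f) (∑ ys f)))

  module _ {P : ℚ → Set} (P0 : P 0ℚ) (P+ : ∀ {p q} → P p → P q → P (p + q)) where

    ∑-closed : ∀ {xs} {f : A → ℚ} → All (P ∘ f) xs → P (∑ xs f)
    ∑-closed []         = P0
    ∑-closed (px ∷ pxs) = P+ px (∑-closed pxs)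

    ∑-except : ∀ {xs a} {f : A → ℚ} → Unique xs → a ∈ xs → (∀ {b} → b ≢ a → P (f b)) →
      Σ[ r ∈ ℚ ] P r × ∑ xs f ≡ f a + r
    ∑-except (a∉ ∷ _) (here refl) Pf = _ , ∑-closed (All.map (λ a≢b → Pf (a≢b ∘ sym)) a∉) , refl
    ∑-except {b ∷ xs} {a} {f} (b∉ ∷ u) (there a∈) Pf with ∑-except u a∈ Pf
    ... | r , Pr , eq = f b + r , P+ (Pf (λ b≡a → All.lookup b∉ a∈ b≡a)) Pr , (begin
      f b + ∑ xs f        ≡⟨ cong (f b +_) eq ⟩
      f b + (f a + r)     ≡⟨ solve 3 (λ x y z → x :+ (y :+ z) := y :+ (x :+ z)) refl (f b) (f a) r ⟩
      f a + (f b + r)     ∎)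
      where open ≡-Reasoning

ι : ℤ → ℚ
ι z = mkℚ z 0 (Coprime.sym (Coprime.1-coprimeTo _))

ι-+ : ∀ a b → ι a + ι b ≡ ι (a ℤ.+ b)
ι-+ a b rewrite ℤ.*-identityʳ a | ℤ.*-identityʳ b = ↥p/↧p≡p (ι (a ℤ.+ b))

ι-neg : ∀ a → - ι a ≡ ι (ℤ.- a)
ι-neg (ℤ.+ 0)     = refl
ι-neg ℤ.+[1+ _ ]  = refl
ι-neg ℤ.-[1+ _ ]  = refl

ι-suc : ∀ n → ι (ℤ.+ suc n) ≡ 1ℚ + ι (ℤ.+ n)
ι-suc n = sym (ι-+ (ℤ.+ 1) (ℤ.+ n))

IsInteger : ℚ → Set
IsInteger q = ∃[ z ] q ≡ ι z

integer-0 : IsInteger 0ℚ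
integer-0 = ℤ.+ 0 , refl

integer-1 : IsInteger 1ℚ
integer-1 = ℤ.+ 1 , refl

integer-+ : ∀ {p q} → IsInteger p → IsInteger q → IsInteger (p + q)
integer-+ (a , refl) (b , refl) = a ℤ.+ b , ι-+ a b

integer-neg : ∀ {p} → IsInteger p → IsInteger (- p)
integer-neg (a , refl) = ℤ.- a , ι-neg a

integer-minus : ∀ {p q} → IsInteger p → IsInteger q → IsInteger (p - q)
integer-minus ip iq = integer-+ ip (integer-neg iq)

0<p<1⇒¬integer : ∀ {p} → 0ℚ < p → p < 1ℚ → ¬ IsInteger p
0<p<1⇒¬integer 0<p _   (ℤ.+ 0 , refl) = <-irrefl refl 0<p
0<p<1⇒¬integer _   p<1 (ℤ.+[1+ n ] , refl) with drop-*<* p<1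
... | lt rewrite ℤ.*-identityʳ ℤ.+[1+ n ] with ℤ.drop‿+<+ lt
...   | ℕ.s≤s ()
0<p<1⇒¬integer 0<p _   (ℤ.-[1+ n ] , refl) with drop-*<* 0<p
... | lt rewrite ℤ.*-identityʳ ℤ.-[1+ n ] with lt
...   | ()

∑-≤-sum : ∀ {A : Set} xs {f : A → ℚ} {k : A → ℕ} → (∀ x → f x ≤ ι (ℤ.+ k x)) →
  ∑ xs f ≤ ι (ℤ.+ sum (map k xs))
∑-≤-sum []            _     = ≤-refl
∑-≤-sum (x ∷ xs) {f} {k} f≤k = ≤-trans (+-mono-≤ (f≤k x) (∑-≤-sum xs f≤k))
  (≤-reflexive (ι-+ (ℤ.+ k x) (ℤ.+ sum (map k xs))))

neg-involutive : ∀ p → - (- p) ≡ p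
neg-involutive = solve 1 (λ p → :- (:- p) := p) refl

0<p⊓q : ∀ {p q} → 0ℚ < p → 0ℚ < q → 0ℚ < p ⊓ q
0<p⊓q {p} {q} 0<p 0<q with ⊓-sel p q
... | inj₁ ⊓≡p = subst (0ℚ <_) (sym ⊓≡p) 0<p
... | inj₂ ⊓≡q = subst (0ℚ <_) (sym ⊓≡q) 0<q

p<1⇒0<1-p : ∀ {p} → p < 1ℚ → 0ℚ < 1ℚ - p
p<1⇒0<1-p {p} p<1 = subst (_< 1ℚ - p) (+-inverseʳ p) (+-monoˡ-< (- p) p<1)

p≤1⇒0≤1-p : ∀ {p} → p ≤ 1ℚ → 0ℚ ≤ 1ℚ - p
p≤1⇒0≤1-p {p} p≤1 = subst (_≤ 1ℚ - p) (+-inverseʳ p) (+-monoˡ-≤ (- p) p≤1)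

0<p⇒p*u≢0 : ∀ {p u} → 0ℚ < p → u * u ≡ 1ℚ → p * u ≢ 0ℚ
0<p⇒p*u≢0 {p} {u} 0<p u²≡1 pu≡0 = <-irrefl (sym p≡0) 0<p
  where
  open ≡-Reasoning
  p≡0 : p ≡ 0ℚ
  p≡0 = begin
    p            ≡⟨ *-identityʳ p ⟨
    p * 1ℚ       ≡⟨ cong (p *_) u²≡1 ⟨
    p * (u * u)  ≡⟨ *-assoc p u u ⟨
    p * u * u    ≡⟨ cong (_* u) pu≡0 ⟩
    0ℚ * u       ≡⟨ *-zeroˡ u ⟩
    0ℚ           ∎

scaled-within : ∀ {ε K μ r q} → 0ℚ ≤ ε → ε * K ≡ μ → μ ≤ r → - K ≤ q → q ≤ K →
  - r ≤ ε * q × ε * q ≤ r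
scaled-within {ε} {K} {μ} {r} {q} 0≤ε εK≡μ μ≤r -K≤q q≤K =
  (begin
    - r          ≤⟨ neg-antimono-≤ μ≤r ⟩
    - μ          ≡⟨ cong -_ εK≡μ ⟨
    - (ε * K)    ≡⟨ neg-distribʳ-* ε K ⟩
    ε * - K      ≤⟨ *-monoˡ-≤-nonNeg ε -K≤q ⟩
    ε * q        ∎) ,
  (begin
    ε * q        ≤⟨ *-monoˡ-≤-nonNeg ε q≤K ⟩
    ε * K        ≡⟨ εK≡μ ⟩
    μ            ≤⟨ μ≤r ⟩
    r            ∎)
  where
  open ≤-Reasoning
  instance
    ε-nonNeg : NonNegative ε
    ε-nonNeg = nonNegative 0≤ε

module Walks {V E : Set} (tail head : E → V) where

  -- (e , true) traverses e from tail to head, (e , false) backwards.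
  Step : Set
  Step = E × Bool

  edge : Step → E
  edge = proj₁

  src dst : Step → V
  src (e , true)  = tail e
  src (e , false) = head e
  dst (e , true)  = head e
  dst (e , false) = tail e

  Walk : V → List Step → V → Set
  Walk a []        b = a ≡ b
  Walk a (st ∷ ws) b = src st ≡ a × Walk (dst st) ws b

  Walk-++ : ∀ {a b c} ws {ws'} → Walk a ws b → Walk b ws' c → Walk a (ws ++ ws') c
  Walk-++ []       refl          w' = w'
  Walk-++ (_ ∷ ws) (refl , w) w' = refl , Walk-++ ws w w'

  Incident : E → V → Set
  Incident e v = tail e ≡ v ⊎ head e ≡ v

  leaving : ∀ {e v} → Incident e v → Bool
  leaving (inj₁ _) = true
  leaving (inj₂ _) = false

  src-leaving : ∀ {e v} (i : Incident e v) → src (e , leaving i) ≡ v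
  src-leaving (inj₁ p) = p
  src-leaving (inj₂ p) = p

  incident-dst : ∀ st → Incident (edge st) (dst st)
  incident-dst (_ , true)  = inj₂ refl
  incident-dst (_ , false) = inj₁ refl

  incident⇒endpoint : ∀ st {u} → Incident (edge st) u → src st ≡ u ⊎ dst st ≡ u
  incident⇒endpoint (_ , true)  i        = i
  incident⇒endpoint (_ , false) (inj₁ p) = inj₂ p
  incident⇒endpoint (_ , false) (inj₂ p) = inj₁ p

  module CycleSearch
    (loopless : ∀ e → tail e ≢ head e)
    (_≟V_ : DecidableEquality V) (vertices : List V) (∈-vertices : ∀ v → v ∈ vertices)
    (Active : E → Set) (t : V)
    (active-at-t? : Dec (∃[ e ] Active e × Incident e t))
    (branch : ∀ {v e} → v ≢ t → Active e → Incident e v → ∃[ e' ] Active e' × Incident e' v × e' ≢ e)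
    where

    open DecMembership _≟V_ using (_∈?_; _∉_)

    record Cycle : Set where
      field
        base    : V
        path    : List Step
        closing : Step
        closed  : Walk base (path ++ [ closing ]) base
        active  : All (Active ∘ edge) (path ++ [ closing ])
        fresh   : All (λ st → edge st ≢ edge closing) path

    missing : List V → List V → ℕ
    missing []       vs = 0
    missing (u ∷ us) vs with u ∈? vs
    ... | yes _ = missing us vs
    ... | no  _ = suc (missing us vs)

    missing-∷-≤ : ∀ us w vs → missing us (w ∷ vs) ℕ.≤ missing us vs
    missing-∷-≤ []       w vs = ℕ.z≤n
    missing-∷-≤ (u ∷ us) w vs with u ∈? vs | u ∈? w ∷ vs
    ... | yes _  | yes _  = missing-∷-≤ us w vs
    ... | yes u∈ | no ¬u∈ = ⊥-elim (¬u∈ (there u∈))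
    ... | no  _  | yes _  = ℕ.m≤n⇒m≤1+n (missing-∷-≤ us w vs)
    ... | no  _  | no  _  = ℕ.s≤s (missing-∷-≤ us w vs)

    missing-∷-< : ∀ us {w vs} → w ∈ us → w ∉ vs → missing us (w ∷ vs) ℕ.< missing us vs
    missing-∷-< (u ∷ us) {w} {vs} w∈ w∉ with u ∈? vs | u ∈? w ∷ vs
    missing-∷-< (u ∷ us) _           _  | yes u∈ | no ¬u∈ = ⊥-elim (¬u∈ (there u∈))
    missing-∷-< (u ∷ us) (here refl) w∉ | yes u∈ | yes _  = ⊥-elim (w∉ u∈)
    missing-∷-< (u ∷ us) (there w∈)  w∉ | yes _  | yes _  = missing-∷-< us w∈ w∉
    missing-∷-< (u ∷ us) {w} {vs} _  _  | no  _  | yes _  = ℕ.s≤s (missing-∷-≤ us w vs)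
    missing-∷-< (u ∷ us) (here refl) _  | no  _  | no ¬u  = ⊥-elim (¬u (here refl))
    missing-∷-< (u ∷ us) (there w∈)  w∉ | no  _  | no  _  = ℕ.s≤s (missing-∷-< us w∈ w∉)

    src≢dst : ∀ st → src st ≢ dst st
    src≢dst (e , true)  = loopless e
    src≢dst (e , false) = loopless e ∘ sym

    -- A visited vertex together with the walk from it to the current vertex.
    Visit : Set
    Visit = V × List Step

    visited : List Visit → List V
    visited = map proj₁

    append : Step → Visit → Visit
    append st p = proj₁ p , proj₂ p ++ [ st ]

    visited-append : ∀ st visits → visited visits ≡ visited (map (append st) visits)
    visited-append st = map-∘

    -- steps-away makes a closing edge fresh: a stored walk touches the current vertex
    -- only through the edge last used to enter it.
    record Trail (cur : V) (last : E) (visits : List Visit) : Set where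
      field
        walks        : ∀ {u ws} → (u , ws) ∈ visits → Walk u ws cur
        steps-active : ∀ {u ws st} → (u , ws) ∈ visits → st ∈ ws → Active (edge st)
        steps-inside : ∀ {u ws st v} → (u , ws) ∈ visits → st ∈ ws → Incident (edge st) v →
                       v ∈ visited visits
        steps-away   : ∀ {u ws st} → (u , ws) ∈ visits → st ∈ ws →
                       edge st ≡ last ⊎ ¬ Incident (edge st) cur
        cur-visited  : cur ∈ visited visits
        cur≢t        : cur ≢ t
        last-active  : Active last
        last-at-cur  : Incident last cur
        t-settled    : t ∈ visited visits ⊎ (∀ {e} → Active e → ¬ Incident e t)

    module _ {cur last visits} (tr : Trail cur last visits)
             {e} (act : Active e) (at-cur : Incident e cur) where
      open Trail tr

      private
        st = (e , leaving at-cur)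

      close : e ≢ last → ∃[ p ] p ∈ visits × dst st ≡ proj₁ p → Cycle
      close e≢last ((u , ws) , visit , dst≡u) = record
        { base    = u
        ; path    = ws
        ; closing = st
        ; closed  = Walk-++ ws (walks visit) (src-leaving at-cur , dst≡u)
        ; active  = All.++⁺ (All.tabulate (steps-active visit)) (act ∷ [])
        ; fresh   = All.tabulate fresh
        }
        where
        fresh : ∀ {st'} → st' ∈ ws → edge st' ≢ e
        fresh st'∈ refl with steps-away visit st'∈
        ... | inj₁ e≡last = e≢last e≡last
        ... | inj₂ away   = away at-cur

      next-visits : List Visit
      next-visits = (dst st , []) ∷ map (append st) visits

      module _ (nxt∉ : dst st ∉ visited visits) where

        lift : ∀ {v} → v ∈ visited visits → v ∈ visited (map (append st) visits)
        lift = subst (_ ∈_) (visited-append st visits)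

        next-walks : ∀ {u ws} → (u , ws) ∈ next-visits → Walk u ws (dst st)
        next-walks (here refl) = refl
        next-walks (there visit) with ∈-map⁻ (append st) visit
        ... | (_ , ws) , old , refl = Walk-++ ws (walks old) (src-leaving at-cur , refl)

        next-steps-active : ∀ {u ws st'} → (u , ws) ∈ next-visits → st' ∈ ws → Active (edge st')
        next-steps-active (here refl) ()
        next-steps-active (there visit) st'∈ with ∈-map⁻ (append st) visit
        ... | (_ , ws) , old , refl with ∈-++⁻ ws st'∈
        ...   | inj₁ st'∈ws      = steps-active old st'∈ws
        ...   | inj₂ (here refl) = act

        next-steps-inside : ∀ {u ws st' v} → (u , ws) ∈ next-visits → st' ∈ ws →
                            Incident (edge st') v → v ∈ visited next-visits
        next-steps-inside (here refl) ()
        next-steps-inside (there visit) st'∈ inc with ∈-map⁻ (append st) visit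
        ... | (_ , ws) , old , refl with ∈-++⁻ ws st'∈
        ...   | inj₁ st'∈ws = there (lift (steps-inside old st'∈ws inc))
        ...   | inj₂ (here refl) with incident⇒endpoint st inc
        ...     | inj₁ refl = there (lift (subst (_∈ visited visits) (sym (src-leaving at-cur))
                                                cur-visited))
        ...     | inj₂ refl = here refl

        next-steps-away : ∀ {u ws st'} → (u , ws) ∈ next-visits → st' ∈ ws →
                          edge st' ≡ e ⊎ ¬ Incident (edge st') (dst st)
        next-steps-away (here refl) ()
        next-steps-away (there visit) st'∈ with ∈-map⁻ (append st) visit
        ... | (_ , ws) , old , refl with ∈-++⁻ ws st'∈
        ...   | inj₁ st'∈ws      = inj₂ (λ inc → nxt∉ (steps-inside old st'∈ws inc))
        ...   | inj₂ (here refl) = inj₁ refl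

        next≢t : dst st ≢ t
        next≢t nxt≡t with t-settled
        ... | inj₁ t∈     = nxt∉ (subst (_∈ visited visits) (sym nxt≡t) t∈)
        ... | inj₂ t-idle = t-idle act (subst (Incident e) nxt≡t (incident-dst st))

        advance : Trail (dst st) e next-visits
        advance = record
          { walks        = next-walks
          ; steps-active = next-steps-active
          ; steps-inside = next-steps-inside
          ; steps-away   = next-steps-away
          ; cur-visited  = here refl
          ; cur≢t        = next≢t
          ; last-active  = act
          ; last-at-cur  = incident-dst st
          ; t-settled    = Sum.map₁ (there ∘ lift) t-settled
          }

    missing-append : ∀ st visits {w} → w ∉ visited visits →
      missing vertices (w ∷ visited (map (append st) visits)) ℕ.< missing vertices (visited visits)
    missing-append st visits {w} w∉ =
      subst (λ vs → missing vertices (w ∷ vs) ℕ.< missing vertices (visited visits))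
            (visited-append st visits) (missing-∷-< vertices (∈-vertices w) w∉)

    -- Every advance visits a new vertex, so the search closes a cycle before running out of fuel.
    search : ∀ fuel {cur last visits} → missing vertices (visited visits) ℕ.< fuel →
             Trail cur last visits → Cycle
    search (suc fuel) {visits = visits} bound tr
      with branch (Trail.cur≢t tr) (Trail.last-active tr) (Trail.last-at-cur tr)
    ... | e , act , at-cur , e≢last with dst (e , leaving at-cur) ∈? visited visits
    ...   | yes nxt∈ = close tr act at-cur e≢last (∈-map⁻ proj₁ nxt∈)
    ...   | no  nxt∉ = search fuel (ℕ.<-≤-trans (missing-append _ visits nxt∉) (ℕ.≤-pred bound))
                                   (advance tr act at-cur nxt∉)

    initial : ∀ st → Active (edge st) → dst st ≢ t →
              t ∈ dst st ∷ src st ∷ [] ⊎ (∀ {e} → Active e → ¬ Incident e t) →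
              Trail (dst st) (edge st) ((dst st , []) ∷ (src st , [ st ]) ∷ [])
    initial st act dst≢t t-settled = record
      { walks        = λ { (here refl) → refl ; (there (here refl)) → refl , refl ; (there (there ())) }
      ; steps-active = λ { (there (here refl)) (here refl) → act
                         ; (here refl) () ; (there (here refl)) (there ()) ; (there (there ())) _ }
      ; steps-inside = λ { (there (here refl)) (here refl) inc → endpoint (incident⇒endpoint st inc)
                         ; (here refl) () _ ; (there (here refl)) (there ()) _ ; (there (there ())) _ _ }
      ; steps-away   = λ { (there (here refl)) (here refl) → inj₁ refl
                         ; (here refl) () ; (there (here refl)) (there ()) ; (there (there ())) _ }
      ; cur-visited  = here refl
      ; cur≢t        = dst≢t
      ; last-active  = act
      ; last-at-cur  = incident-dst st
      ; t-settled    = t-settled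
      }
      where
      endpoint : ∀ {v} → src st ≡ v ⊎ dst st ≡ v → v ∈ dst st ∷ src st ∷ []
      endpoint (inj₁ refl) = there (here refl)
      endpoint (inj₂ refl) = here refl

    cycle : ∀ {e} → Active e → Cycle
    cycle {e} act = start active-at-t?
      where
      start : Dec (∃[ e ] Active e × Incident e t) → Cycle
      start (yes (e' , act' , at-t)) =
        search _ ℕ.≤-refl (initial st act' (src≢dst st ∘ trans (src-leaving at-t) ∘ sym)
                                   (inj₁ (there (here (sym (src-leaving at-t))))))
        where st = (e' , leaving at-t)
      start (no t-idle) =
        search _ ℕ.≤-refl (initial (e , true) act (λ head≡t → t-idle (e , act , inj₂ head≡t))
                                   (inj₂ (λ act' at-t → t-idle (_ , act' , at-t))))

module AuxiliaryGraph (I : Instance) where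
  open Instance I

  eqSlot-sound : ∀ p q → T (eqSlot I p q) → p ≡ q
  eqSlot-sound (j , k) (j' , k') eq with Equivalence.to (T-∧ {⌊ j ≟F j' ⌋} {⌊ k ≟F k' ⌋}) eq
  ... | j≡ , k≡ = cong₂ _,_ (toWitness j≡) (toWitness k≡)

  eqSlot-refl : ∀ p → T (eqSlot I p p)
  eqSlot-refl (j , k) = Equivalence.from (T-∧ {⌊ j ≟F j ⌋} {⌊ k ≟F k ⌋})
                          (fromWitness {a? = j ≟F j} refl , fromWitness {a? = k ≟F k} refl)

  eqV-sound : ∀ u v → T (eqV I u v) → u ≡ v
  eqV-sound s      s      _  = refl
  eqV-sound t      t      _  = refl
  eqV-sound (vv p) (vv q) eq = cong vv (eqSlot-sound p q eq)
  eqV-sound (ww p) (ww q) eq = cong ww (eqSlot-sound p q eq)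
  eqV-sound s      t      ()
  eqV-sound s      (vv _) ()
  eqV-sound s      (ww _) ()
  eqV-sound t      s      ()
  eqV-sound t      (vv _) ()
  eqV-sound t      (ww _) ()
  eqV-sound (vv _) s      ()
  eqV-sound (vv _) t      ()
  eqV-sound (vv _) (ww _) ()
  eqV-sound (ww _) s      ()
  eqV-sound (ww _) t      ()
  eqV-sound (ww _) (vv _) ()

  eqV-refl : ∀ u → T (eqV I u u)
  eqV-refl s      = _
  eqV-refl t      = _
  eqV-refl (vv p) = eqSlot-refl p
  eqV-refl (ww p) = eqSlot-refl p

  _≟V_ : DecidableEquality (Vertex I)
  u ≟V v = eqV I u v because fromEquivalence (eqV-sound u v) (λ { refl → eqV-refl u })

  _≟S_ : DecidableEquality (Slot I)
  p ≟S q = eqSlot I p q because fromEquivalence (eqSlot-sound p q) (λ { refl → eqSlot-refl p })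

  encode : RawEdge I → (Slot I ⊎ Slot I) ⊎ (Slot I ⊎ Slot I × Slot I)
  encode (itemR p)    = inj₁ (inj₁ p)
  encode (srcR p)     = inj₁ (inj₂ p)
  encode (snkR p)     = inj₂ (inj₁ p)
  encode (transR p q) = inj₂ (inj₂ (p , q))

  decode : (Slot I ⊎ Slot I) ⊎ (Slot I ⊎ Slot I × Slot I) → RawEdge I
  decode (inj₁ (inj₁ p))       = itemR p
  decode (inj₁ (inj₂ p))       = srcR p
  decode (inj₂ (inj₁ p))       = snkR p
  decode (inj₂ (inj₂ (p , q))) = transR p q

  decode-encode : ∀ r → decode (encode r) ≡ r
  decode-encode (itemR _)    = refl
  decode-encode (srcR _)     = refl
  decode-encode (snkR _)     = refl
  decode-encode (transR _ _) = refl

  _≟R_ : DecidableEquality (RawEdge I)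
  _≟R_ = ≡-dec-via-retraction encode decode decode-encode
           (⊎.≡-dec (⊎.≡-dec _≟S_ _≟S_) (⊎.≡-dec _≟S_ (×.≡-dec _≟S_ _≟S_)))

  Edge≡ : {e e' : Edge I} → proj₁ e ≡ proj₁ e' → e ≡ e'
  Edge≡ {r , pr} refl = cong (r ,_) (T-irrelevant pr _)

  _≟E_ : DecidableEquality (Edge I)
  e ≟E e' = map′ Edge≡ (cong proj₁) (proj₁ e ≟R proj₁ e')

  slots-unique : Unique (slots I)
  slots-unique = Unique.cartesianProduct⁺ (Unique.allFin⁺ m) (Unique.allFin⁺ nT)

  ∈-slots : ∀ p → p ∈ slots I
  ∈-slots (j , k) = ∈-cartesianProduct⁺ (∈-allFin j) (∈-allFin k)

  rawEdges-unique : Unique (rawEdges I)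
  rawEdges-unique =
    Unique.++⁺ {xs = items} (Unique.map⁺ itemR-injective slots-unique)
      (Unique.++⁺ {xs = sources} (Unique.map⁺ srcR-injective slots-unique)
        (Unique.++⁺ {xs = sinks} (Unique.map⁺ snkR-injective slots-unique)
          (Unique.map⁺ transR-injective (Unique.cartesianProduct⁺ slots-unique slots-unique))
          (disjoint-map λ _ _ ()))
        (disjoint-++ {ys = sinks} (disjoint-map λ _ _ ()) (disjoint-map λ _ _ ())))
      (disjoint-++ {ys = sources} (disjoint-map λ _ _ ())
        (disjoint-++ {ys = sinks} (disjoint-map λ _ _ ()) (disjoint-map λ _ _ ())))
    where
    items sources sinks : List (RawEdge I)
    items   = map itemR (slots I)
    sources = map srcR (slots I)
    sinks   = map snkR (slots I)
    itemR-injective : ∀ {p q} → itemR {I} p ≡ itemR q → p ≡ q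
    itemR-injective refl = refl
    srcR-injective : ∀ {p q} → srcR {I} p ≡ srcR q → p ≡ q
    srcR-injective refl = refl
    snkR-injective : ∀ {p q} → snkR {I} p ≡ snkR q → p ≡ q
    snkR-injective refl = refl
    transR-injective : ∀ {pq pq'} → uncurry (transR {I}) pq ≡ uncurry transR pq' → pq ≡ pq'
    transR-injective {_ , _} {_ , _} refl = refl

  ∈-rawEdges : ∀ r → r ∈ rawEdges I
  ∈-rawEdges (itemR p)    = ∈-++⁺ˡ (∈-map⁺ itemR (∈-slots p))
  ∈-rawEdges (srcR p)     = ∈-++⁺ʳ (map itemR (slots I)) (∈-++⁺ˡ (∈-map⁺ srcR (∈-slots p)))
  ∈-rawEdges (snkR p)     = ∈-++⁺ʳ (map itemR (slots I)) (∈-++⁺ʳ (map srcR (slots I))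
                              (∈-++⁺ˡ (∈-map⁺ snkR (∈-slots p))))
  ∈-rawEdges (transR p q) = ∈-++⁺ʳ (map itemR (slots I)) (∈-++⁺ʳ (map srcR (slots I))
                              (∈-++⁺ʳ (map snkR (slots I))
                                (∈-map⁺ (uncurry transR) (∈-cartesianProduct⁺ (∈-slots p) (∈-slots q)))))

  vertices : List (Vertex I)
  vertices = s ∷ t ∷ map vv (slots I) ++ map ww (slots I)

  ∈-vertices : ∀ v → v ∈ vertices
  ∈-vertices s      = here refl
  ∈-vertices t      = there (here refl)
  ∈-vertices (vv p) = there (there (∈-++⁺ˡ (∈-map⁺ vv (∈-slots p))))
  ∈-vertices (ww p) = there (there (∈-++⁺ʳ (map vv (slots I)) (∈-map⁺ ww (∈-slots p))))

  extend : (Edge I → ℚ) → RawEdge I → ℚ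
  extend f r = guardQ I (isEdge I r) (λ pr → f (r , pr))

  guard-at : ∀ b (g : T b → ℚ) pr → guardQ I b g ≡ g pr
  guard-at true _ _ = refl

  guard-elim : ∀ {P : ℚ → Set} b {g : T b → ℚ} → P 0ℚ → (∀ pr → P (g pr)) → P (guardQ I b g)
  guard-elim true  _  Pg = Pg _
  guard-elim false P0 _  = P0

  guard-linear : ∀ b {f g h : T b → ℚ} a c → (∀ pr → f pr ≡ a * g pr + c * h pr) →
    guardQ I b f ≡ a * guardQ I b g + c * guardQ I b h
  guard-linear true  a c f≡ = f≡ _
  guard-linear false a c _  = solve 2 (λ a c → con 0ℚ := a :* con 0ℚ :+ c :* con 0ℚ) refl a c

  ΣE-linear : ∀ {f g h : Edge I → ℚ} a c → (∀ e → f e ≡ a * g e + c * h e) →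
    ΣE I f ≡ a * ΣE I g + c * ΣE I h
  ΣE-linear a c f≡ =
    ∑-linear (rawEdges I) a c (λ r → guard-linear (isEdge I r) a c (λ pr → f≡ (r , pr)))

  module _ {P : ℚ → Set} (P0 : P 0ℚ) (P+ : ∀ {p q} → P p → P q → P (p + q)) where

    ΣE-except : ∀ {f : Edge I → ℚ} e → (∀ {e'} → e' ≢ e → P (f e')) → Σ[ r ∈ ℚ ] P r × ΣE I f ≡ f e + r
    ΣE-except {f} e@(r , pr) Pf with ∑-except P0 P+ rawEdges-unique (∈-rawEdges r) Pextend
      where
      Pextend : ∀ {r'} → r' ≢ r → P (extend f r')
      Pextend {r'} r'≢r = guard-elim {P} (isEdge I r') P0 (λ _ → Pf (r'≢r ∘ cong proj₁))
    ... | rest , Prest , eq = rest , Prest , trans eq (cong (_+ rest) (guard-at (isEdge I r) _ pr))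

  ΣE-single : ∀ {f : Edge I → ℚ} e → (∀ {e'} → e' ≢ e → f e' ≡ 0ℚ) → ΣE I f ≡ f e
  ΣE-single {f} e f≡0 with ΣE-except {P = _≡ 0ℚ} refl (λ { refl refl → refl }) e f≡0
  ... | _ , refl , eq = trans eq (+-identityʳ (f e))

  ΣE-≤-countE : ∀ (P : Edge I → Bool) {y : Edge I → ℚ} → (∀ e → y e ≤ 1ℚ) →
    ΣE I (λ e → if P e then y e else 0ℚ) ≤ ι (ℤ.+ countE I P)
  ΣE-≤-countE P y≤1 = ∑-≤-sum (rawEdges I) (λ r → guard-≤ (isEdge I r) (λ pr → y≤1 (r , pr)))
    where
    guard-≤ : ∀ b {Q : T b → Bool} {g : T b → ℚ} → (∀ pr → g pr ≤ 1ℚ) →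
      guardQ I b (λ pr → if Q pr then g pr else 0ℚ) ≤ ι (ℤ.+ guardN I b (λ pr → if Q pr then 1 else 0))
    guard-≤ false _ = ≤-refl
    guard-≤ true {Q} g≤1 with Q _
    ... | true  = g≤1 _
    ... | false = ≤-refl

  ∃-edge? : {P : Edge I → Set} → (∀ e → Dec (P e)) → Dec (∃ P)
  ∃-edge? {P} P? = map′ (λ any → let r , pr , p = satisfied {P = OnEdge} any in (r , pr) , p)
                        (λ { ((r , pr) , p) → lose (∈-rawEdges r) (pr , p) })
                        (any? (λ r → guarded (isEdge I r) (λ pr → P? (r , pr))) (rawEdges I))
    where
    OnEdge : RawEdge I → Set
    OnEdge r = Σ (T (isEdge I r)) λ pr → P (r , pr)
    guarded : ∀ b {Q : T b → Set} → (∀ pr → Dec (Q pr)) → Dec (Σ (T b) Q)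
    guarded true  Q? = map′ (_ ,_) proj₂ (Q? _)
    guarded false _  = no proj₁

  loopless : ∀ e → tail I e ≢ head I e
  loopless (itemR _ , _)    ()
  loopless (srcR _ , _)     ()
  loopless (snkR _ , _)     ()
  loopless (transR _ _ , _) ()

  open Walks (tail I) (head I) public

  Incident? : ∀ e v → Dec (Incident e v)
  Incident? e v = (tail I e ≟V v) ⊎-dec (head I e ≟V v)

  -- does (u ≟V v) is definitionally eqV I u v, the test used by outFlow and inFlow.
  ind : Vertex I → Vertex I → ℚ
  ind u v = if does (u ≟V v) then 1ℚ else 0ℚ

  ind-≡ : ∀ {u v} → u ≡ v → ind u v ≡ 1ℚ
  ind-≡ = if-yes (_ ≟V _)

  ind-≢ : ∀ {u v} → u ≢ v → ind u v ≡ 0ℚ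
  ind-≢ = if-no (_ ≟V _)

  ind-integer : ∀ u v → IsInteger (ind u v)
  ind-integer u v with eqV I u v
  ... | true  = integer-1
  ... | false = integer-0

  incidence : Vertex I → Edge I → ℚ
  incidence v e = ind (tail I e) v - ind (head I e) v

  incidence-integer : ∀ v e → IsInteger (incidence v e)
  incidence-integer v e = integer-minus (ind-integer (tail I e) v) (ind-integer (head I e) v)

  incidence-off : ∀ {v e} → ¬ Incident e v → incidence v e ≡ 0ℚ
  incidence-off ¬inc = cong₂ _-_ (ind-≢ (¬inc ∘ inj₁)) (ind-≢ (¬inc ∘ inj₂))

  incidence-on : ∀ {v e} → Incident e v → incidence v e ≡ 1ℚ ⊎ incidence v e ≡ - 1ℚ
  incidence-on {e = e} (inj₁ refl) = inj₁ (cong₂ _-_ (ind-≡ {tail I e} refl) (ind-≢ (loopless e ∘ sym)))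
  incidence-on {e = e} (inj₂ refl) = inj₂ (cong₂ _-_ (ind-≢ (loopless e)) (ind-≡ {head I e} refl))

  net : (Edge I → ℚ) → Vertex I → ℚ
  net y v = outFlow I y v - inFlow I y v

  net-incidence : ∀ y v → net y v ≡ ΣE I (λ e → incidence v e * y e)
  net-incidence y v = begin
    outFlow I y v - inFlow I y v
      ≡⟨ solve 2 (λ a b → a :- b := con 1ℚ :* a :+ con (- 1ℚ) :* b) refl (outFlow I y v) (inFlow I y v) ⟩
    1ℚ * outFlow I y v + - 1ℚ * inFlow I y v
      ≡⟨ ΣE-linear 1ℚ (- 1ℚ) pointwise ⟨
    ΣE I (λ e → incidence v e * y e)  ∎
    where
    open ≡-Reasoning
    scale : ∀ b q → (if b then 1ℚ else 0ℚ) * q ≡ (if b then q else 0ℚ)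
    scale true  q = *-identityˡ q
    scale false q = *-zeroˡ q
    pointwise : ∀ e → incidence v e * y e ≡
      1ℚ * (if eqV I (tail I e) v then y e else 0ℚ) + - 1ℚ * (if eqV I (head I e) v then y e else 0ℚ)
    pointwise e = trans
      (solve 3 (λ a b q → (a :- b) :* q := con 1ℚ :* (a :* q) :+ con (- 1ℚ) :* (b :* q)) refl
        (ind (tail I e) v) (ind (head I e) v) (y e))
      (cong₂ (λ p q → 1ℚ * p + - 1ℚ * q)
             (scale (eqV I (tail I e) v) (y e)) (scale (eqV I (head I e) v) (y e)))

  net-linear : ∀ {f g h : Edge I → ℚ} a c → (∀ e → f e ≡ a * g e + c * h e) →
    ∀ v → net f v ≡ a * net g v + c * net h v
  net-linear {f} {g} {h} a c f≡ v = begin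
    net f v                                   ≡⟨ net-incidence f v ⟩
    ΣE I (λ e → incidence v e * f e)          ≡⟨ ΣE-linear a c pointwise ⟩
    a * ΣE I (λ e → incidence v e * g e) + c * ΣE I (λ e → incidence v e * h e)
      ≡⟨ cong₂ (λ p q → a * p + c * q) (net-incidence g v) (net-incidence h v) ⟨
    a * net g v + c * net h v                 ∎
    where
    open ≡-Reasoning
    pointwise : ∀ e → incidence v e * f e ≡ a * (incidence v e * g e) + c * (incidence v e * h e)
    pointwise e = trans (cong (incidence v e *_) (f≡ e))
      (solve 5 (λ i a c g h → i :* (a :* g :+ c :* h) := a :* (i :* g) :+ c :* (i :* h)) refl
        (incidence v e) a c (g e) (h e))

  net-+ : ∀ f g v → net (λ e → f e + g e) v ≡ net f v + net g v
  net-+ f g v = trans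
    (net-linear 1ℚ 1ℚ (λ e → solve 2 (λ p q → p :+ q := con 1ℚ :* p :+ con 1ℚ :* q) refl (f e) (g e)) v)
    (solve 2 (λ p q → con 1ℚ :* p :+ con 1ℚ :* q := p :+ q) refl (net f v) (net g v))

  net-scale : ∀ c f v → net (λ e → c * f e) v ≡ c * net f v
  net-scale c f v = trans
    (net-linear c 0ℚ (λ e → solve 2 (λ c p → c :* p := c :* p :+ con 0ℚ :* p) refl c (f e)) v)
    (solve 2 (λ c n → c :* n :+ con 0ℚ :* n := c :* n) refl c (net f v))

  net-neg : ∀ f v → net (λ e → - f e) v ≡ - net f v
  net-neg f v = trans
    (net-linear (- 1ℚ) 0ℚ (λ e → solve 1 (λ p → :- p := con (- 1ℚ) :* p :+ con 0ℚ :* p) refl (f e)) v)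
    (solve 1 (λ n → con (- 1ℚ) :* n :+ con 0ℚ :* n := :- n) refl (net f v))

  sign : Bool → ℚ
  sign true  = 1ℚ
  sign false = - 1ℚ

  sign² : ∀ b → sign b * sign b ≡ 1ℚ
  sign² true  = refl
  sign² false = refl

  sign-bounded : ∀ b → - 1ℚ ≤ sign b × sign b ≤ 1ℚ
  sign-bounded true  = from-yes (- 1ℚ ≤? 1ℚ) , ≤-refl
  sign-bounded false = ≤-refl , from-yes (- 1ℚ ≤? 1ℚ)

  traversal : Step → Edge I → ℚ
  traversal st e = if does (e ≟E edge st) then sign (proj₂ st) else 0ℚ

  flow : List Step → Edge I → ℚ
  flow ws e = ∑ ws (λ st → traversal st e)

  net-traversal : ∀ st v → net (traversal st) v ≡ ind (src st) v - ind (dst st) v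
  net-traversal st@(e , b) v = begin
    net (traversal st) v                             ≡⟨ net-incidence _ v ⟩
    ΣE I (λ e' → incidence v e' * traversal st e')  ≡⟨ ΣE-single e off ⟩
    incidence v e * traversal st e                   ≡⟨ cong (incidence v e *_) (if-yes (e ≟E e) refl) ⟩
    incidence v e * sign b                           ≡⟨ oriented b ⟩
    ind (src st) v - ind (dst st) v                  ∎
    where
    open ≡-Reasoning
    off : ∀ {e'} → e' ≢ e → incidence v e' * traversal st e' ≡ 0ℚ
    off {e'} e'≢e = trans (cong (incidence v e' *_) (if-no (e' ≟E e) e'≢e)) (*-zeroʳ (incidence v e'))
    oriented : ∀ b → incidence v e * sign b ≡ ind (src (e , b)) v - ind (dst (e , b)) v
    oriented true  = *-identityʳ (incidence v e)
    oriented false = solve 2 (λ a c → (a :- c) :* con (- 1ℚ) := c :- a) refl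
                       (ind (tail I e) v) (ind (head I e) v)

  net-flow : ∀ {a b} ws → Walk a ws b → ∀ v → net (flow ws) v ≡ ind a v - ind b v
  net-flow {a} [] refl v = begin
    net (flow []) v       ≡⟨ net-scale 0ℚ (flow []) v ⟩
    0ℚ * net (flow []) v  ≡⟨ *-zeroˡ (net (flow []) v) ⟩
    0ℚ                    ≡⟨ +-inverseʳ (ind a v) ⟨
    ind a v - ind a v     ∎
    where open ≡-Reasoning
  net-flow {b = b} (st ∷ ws) (refl , w) v = begin
    net (flow (st ∷ ws)) v
      ≡⟨ net-+ (traversal st) (flow ws) v ⟩
    net (traversal st) v + net (flow ws) v
      ≡⟨ cong₂ _+_ (net-traversal st v) (net-flow ws w v) ⟩
    (ind (src st) v - ind (dst st) v) + (ind (dst st) v - ind b v)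
      ≡⟨ solve 3 (λ x y z → (x :- y) :+ (y :- z) := x :- z) refl
           (ind (src st) v) (ind (dst st) v) (ind b v) ⟩
    ind (src st) v - ind b v
      ∎
    where open ≡-Reasoning

  net-flow-closed : ∀ {a} ws → Walk a ws a → ∀ v → net (flow ws) v ≡ 0ℚ
  net-flow-closed {a} ws w v = trans (net-flow ws w v) (+-inverseʳ (ind a v))

  traversal-bounded : ∀ st e → - 1ℚ ≤ traversal st e × traversal st e ≤ 1ℚ
  traversal-bounded st e with if-cases {p = sign (proj₂ st)} {q = 0ℚ} (does (e ≟E edge st))
  ... | inj₁ eq = subst (λ q → - 1ℚ ≤ q × q ≤ 1ℚ) (sym eq) (sign-bounded (proj₂ st))
  ... | inj₂ eq = subst (λ q → - 1ℚ ≤ q × q ≤ 1ℚ) (sym eq) (from-yes (- 1ℚ ≤? 0ℚ) , from-yes (0ℚ ≤? 1ℚ))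

  flow-bounded : ∀ ws e → - ι (ℤ.+ length ws) ≤ flow ws e × flow ws e ≤ ι (ℤ.+ length ws)
  flow-bounded []        e = ≤-refl , ≤-refl
  flow-bounded (st ∷ ws) e with traversal-bounded st e | flow-bounded ws e
  ... | st-lower , st-upper | ws-lower , ws-upper = lower , upper
    where
    open ≤-Reasoning
    L = ι (ℤ.+ length ws)
    lower = begin
      - ι (ℤ.+ suc (length ws))  ≡⟨ cong -_ (ι-suc (length ws)) ⟩
      - (1ℚ + L)                 ≡⟨ neg-distrib-+ 1ℚ L ⟩
      - 1ℚ + - L                 ≤⟨ +-mono-≤ st-lower ws-lower ⟩
      flow (st ∷ ws) e           ∎
    upper = begin
      flow (st ∷ ws) e           ≤⟨ +-mono-≤ st-upper ws-upper ⟩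
      1ℚ + L                     ≡⟨ ι-suc (length ws) ⟨
      ι (ℤ.+ suc (length ws))    ∎

  flow-support : ∀ ws e → flow ws e ≡ 0ℚ ⊎ Any (λ st → edge st ≡ e) ws
  flow-support ws e with any? (λ st → edge st ≟E e) ws
  ... | yes on = inj₂ on
  ... | no off = inj₁ (∑-closed {P = _≡ 0ℚ} refl (λ { refl refl → refl })
                         (All.map (λ ≢e → if-no (e ≟E _) (≢e ∘ sym)) (All.¬Any⇒All¬ ws off)))

module Solution (I : Instance) (δ : ℕ) {x : Edge I → ℚ} (feasible : Feasible I δ x) where
  open AuxiliaryGraph I
  open Feasible feasible

  Fractional : Edge I → Set
  Fractional e = 0ℚ < x e × x e < 1ℚ

  fractional? : ∀ e → Dec (Fractional e)
  fractional? e = (0ℚ <? x e) ×-dec (x e <? 1ℚ)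

  ¬fractional⇒0∨1 : ∀ e → ¬ Fractional e → x e ≡ 0ℚ ⊎ x e ≡ 1ℚ
  ¬fractional⇒0∨1 e ¬frac with 0ℚ <? x e | x e <? 1ℚ
  ... | no  x≯0 | _       = inj₁ (≤-antisym (≮⇒≥ x≯0) (lower e))
  ... | yes _   | no  x≮1 = inj₂ (≤-antisym (upper e) (≮⇒≥ x≮1))
  ... | yes 0<x | yes x<1 = ⊥-elim (¬frac (0<x , x<1))

  net-integer : ∀ {v} → v ≢ t → IsInteger (net x v)
  net-integer {v} v≢t with v ≟V s
  ... | yes refl = ℤ.+ δ , trans source (↥p/↧p≡p (ι (ℤ.+ δ)))
  ... | no  v≢s  = ℤ.+ 0 , conserv v v≢s v≢t

  fractional-partner : ∀ {v e} → v ≢ t → Fractional e → Incident e v →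
    ∃[ e' ] Fractional e' × Incident e' v × e' ≢ e
  fractional-partner {v} {e} v≢t (0<x , x<1) inc
    with ∃-edge? (λ e' → fractional? e' ×-dec Incident? e' v ×-dec ¬? (e' ≟E e))
  ... | yes (e' , frac , inc' , e'≢e) = e' , frac , inc' , e'≢e
  ... | no none = ⊥-elim (0<p<1⇒¬integer 0<x x<1 x-integer)
    where
    other-term-integer : ∀ {e'} → e' ≢ e → IsInteger (incidence v e' * x e')
    other-term-integer {e'} e'≢e with Incident? e' v | fractional? e'
    ... | no ¬inc | _        =
      ℤ.+ 0 , trans (cong (_* x e') (incidence-off {v} {e'} ¬inc)) (*-zeroˡ (x e'))
    ... | yes inc | yes frac = ⊥-elim (none (e' , frac , inc , e'≢e))
    ... | yes _   | no ¬frac with ¬fractional⇒0∨1 e' ¬frac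
    ...   | inj₁ x≡0 = ℤ.+ 0 , trans (cong (incidence v e' *_) x≡0) (*-zeroʳ (incidence v e'))
    ...   | inj₂ x≡1 = subst IsInteger (sym (trans (cong (incidence v e' *_) x≡1) (*-identityʳ _)))
                             (incidence-integer v e')

    term-integer : IsInteger (incidence v e * x e)
    term-integer with ΣE-except integer-0 integer-+ e other-term-integer
    ... | r , r-integer , ΣE≡ = subst IsInteger (sym term≡) (integer-minus (net-integer v≢t) r-integer)
      where
      term≡ : incidence v e * x e ≡ net x v - r
      term≡ = trans (solve 2 (λ a r → a := (a :+ r) :- r) refl (incidence v e * x e) r)
                    (cong (_- r) (sym (trans (net-incidence x v) ΣE≡)))

    x-integer : IsInteger (x e)
    x-integer with incidence-on {v} {e} inc
    ... | inj₁ inc≡1  = subst IsInteger (trans (cong (_* x e) inc≡1) (*-identityˡ (x e))) term-integer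
    ... | inj₂ inc≡-1 = subst IsInteger (trans (cong (λ i → - (i * x e)) inc≡-1)
                                                (solve 1 (λ a → :- (con (- 1ℚ) :* a) := a) refl (x e)))
                             (integer-neg term-integer)

  open CycleSearch loopless _≟V_ vertices ∈-vertices Fractional t
         (∃-edge? (λ e → fractional? e ×-dec Incident? e t)) fractional-partner public

  slack : Edge I → ℚ
  slack e = x e ⊓ (1ℚ - x e)

  slack-nonneg : ∀ e → 0ℚ ≤ slack e
  slack-nonneg e = ⊓-glb (lower e) (p≤1⇒0≤1-p (upper e))

  fractional⇒0<slack : ∀ {e} → Fractional e → 0ℚ < slack e
  fractional⇒0<slack (0<x , x<1) = 0<p⊓q 0<x (p<1⇒0<1-p x<1)

  WithinSlack : (Edge I → ℚ) → Set
  WithinSlack g = ∀ e → - slack e ≤ g e × g e ≤ slack e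

  withinSlack-neg : ∀ {g} → WithinSlack g → WithinSlack (λ e → - g e)
  withinSlack-neg {g} within e =
    neg-antimono-≤ (proj₂ (within e)) ,
    subst (- g e ≤_) (neg-involutive (slack e)) (neg-antimono-≤ (proj₁ (within e)))

  shift-feasible : (∀ i → sizeE-item I i ≡ 1) → ∀ {g} → (∀ v → net g v ≡ 0ℚ) → WithinSlack g →
    Feasible I δ (λ e → x e + g e)
  shift-feasible unit-items {g} circulation within = record
    { itemCap = λ i → subst (itemLoad I y i ≤_) (cong (λ k → ι (ℤ.+ k)) (unit-items i))
                            (ΣE-≤-countE (λ e → eqItem I (itemOf I e) i) upper′)
    ; conserv = λ v v≢s v≢t → trans (net-shift v) (conserv v v≢s v≢t)
    ; source  = trans (net-shift s) source
    ; lower   = lower′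
    ; upper   = upper′
    }
    where
    y : Edge I → ℚ
    y e = x e + g e

    net-shift : ∀ v → net y v ≡ net x v
    net-shift v =
      trans (net-+ x g v) (trans (cong (net x v +_) (circulation v)) (+-identityʳ (net x v)))

    lower′ : ∀ e → 0ℚ ≤ y e
    lower′ e = begin
      0ℚ            ≡⟨ +-inverseʳ (x e) ⟨
      x e + - x e   ≤⟨ +-monoʳ-≤ (x e) (≤-trans (neg-antimono-≤ (p⊓q≤p (x e) _)) (proj₁ (within e))) ⟩
      x e + g e     ∎
      where open ≤-Reasoning

    upper′ : ∀ e → y e ≤ 1ℚ
    upper′ e = begin
      x e + g e           ≤⟨ +-monoʳ-≤ (x e) (≤-trans (proj₂ (within e)) (p⊓q≤q (x e) (1ℚ - x e))) ⟩
      x e + (1ℚ - x e)    ≡⟨ solve 1 (λ a → a :+ (con 1ℚ :- a) := con 1ℚ) refl (x e) ⟩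
      1ℚ                  ∎
      where open ≤-Reasoning

  minSlack : List Step → ℚ
  minSlack = foldr (λ st m → slack (edge st) ⊓ m) 1ℚ

  minSlack-pos : ∀ {ws} → All (Fractional ∘ edge) ws → 0ℚ < minSlack ws
  minSlack-pos []             = from-yes (0ℚ <? 1ℚ)
  minSlack-pos (frac ∷ fracs) = 0<p⊓q (fractional⇒0<slack frac) (minSlack-pos fracs)

  minSlack-≤ : ∀ {ws e} → Any (λ st → edge st ≡ e) ws → minSlack ws ≤ slack e
  minSlack-≤ {st ∷ ws} (here refl) = p⊓q≤p (slack (edge st)) (minSlack ws)
  minSlack-≤ {st ∷ ws} (there on)  = ≤-trans (p⊓q≤q (slack (edge st)) (minSlack ws)) (minSlack-≤ on)

  -- x is the midpoint of the feasible solutions x + g and x - g.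
  circulation⇒¬basic : (∀ i → sizeE-item I i ≡ 1) → ∀ {g} → (∀ v → net g v ≡ 0ℚ) → WithinSlack g →
    ∀ e → g e ≢ 0ℚ → ¬ Basic I δ x
  circulation⇒¬basic unit-items {g} circulation within e g≢0 (_ , extreme) = g≢0 (begin
    g e                  ≡⟨ solve 2 (λ a b → b := con ½ :* ((a :+ b) :- (a :+ :- b))) refl (x e) (g e) ⟩
    ½ * (y e - z e)      ≡⟨ cong (λ q → ½ * (q - z e)) y≡z ⟩
    ½ * (z e - z e)      ≡⟨ solve 1 (λ a → con ½ :* (a :- a) := con 0ℚ) refl (z e) ⟩
    0ℚ                   ∎)
    where
    open ≡-Reasoning
    y z : Edge I → ℚ
    y e = x e + g e
    z e = x e + - g e

    midpoint : ∀ e → x e ≡ ½ * y e + (1ℚ - ½) * z e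
    midpoint e =
      solve 2 (λ a b → a := con ½ :* (a :+ b) :+ (con 1ℚ :- con ½) :* (a :+ :- b)) refl (x e) (g e)

    y≡z : y e ≡ z e
    y≡z = extreme y z ½
      (shift-feasible unit-items circulation within)
      (shift-feasible unit-items (λ v → trans (net-neg g v) (cong -_ (circulation v)))
                                 (withinSlack-neg within))
      (from-yes (0ℚ <? ½)) (from-yes (½ <? 1ℚ)) midpoint e

  -- ±1 along the cycle, scaled so that no edge leaves its slack.
  module Perturbation (C : Cycle) where
    open Cycle C

    walk : List Step
    walk = path ++ [ closing ]

    L K μ ε : ℚ
    L = ι (ℤ.+ length walk)
    K = 1ℚ + L
    μ = minSlack walk

    instance
      L-nonNeg : NonNegative L
      L-nonNeg = _
      K-pos : Positive K
      K-pos = pos+nonNeg⇒pos 1ℚ L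
      K-nonZero : NonZero K
      K-nonZero = pos⇒nonZero K
      μ-pos : Positive μ
      μ-pos = positive (minSlack-pos active)

    ε = μ * 1/ K

    ε-pos : 0ℚ < ε
    ε-pos = positive⁻¹ ε {{pos*pos⇒pos μ (1/ K) {{1/pos⇒pos K}}}}

    εK≡μ : ε * K ≡ μ
    εK≡μ = trans (*-assoc μ (1/ K) K) (trans (cong (μ *_) (*-inverseˡ K)) (*-identityʳ μ))

    g : Edge I → ℚ
    g e = ε * flow walk e

    g-circulation : ∀ v → net g v ≡ 0ℚ
    g-circulation v = begin
      net g v                 ≡⟨ net-scale ε (flow walk) v ⟩
      ε * net (flow walk) v   ≡⟨ cong (ε *_) (net-flow-closed walk closed v) ⟩
      ε * 0ℚ                  ≡⟨ *-zeroʳ ε ⟩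
      0ℚ                      ∎
      where open ≡-Reasoning

    g-within : WithinSlack g
    g-within e with flow-support walk e
    ... | inj₁ flow≡0 = subst (λ q → - slack e ≤ q × q ≤ slack e)
                          (sym (trans (cong (ε *_) flow≡0) (*-zeroʳ ε)))
                          (neg-antimono-≤ (slack-nonneg e) , slack-nonneg e)
    ... | inj₂ on = scaled-within (<⇒≤ ε-pos) εK≡μ (minSlack-≤ on)
                      (≤-trans (neg-antimono-≤ L≤K) (proj₁ (flow-bounded walk e)))
                      (≤-trans (proj₂ (flow-bounded walk e)) L≤K)
      where
      L≤K : L ≤ K
      L≤K = subst (_≤ K) (+-identityˡ L) (+-monoˡ-≤ L (from-yes (0ℚ ≤? 1ℚ)))

    flow-closing : flow walk (edge closing) ≡ sign (proj₂ closing)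
    flow-closing = begin
      flow walk (edge closing)
        ≡⟨ ∑-++ path ⟩
      flow path (edge closing) + (traversal closing (edge closing) + 0ℚ)
        ≡⟨ cong₂ _+_ path-zero (trans (+-identityʳ _) (if-yes (edge closing ≟E edge closing) refl)) ⟩
      0ℚ + sign (proj₂ closing)
        ≡⟨ +-identityˡ _ ⟩
      sign (proj₂ closing) ∎
      where
      open ≡-Reasoning
      path-zero : flow path (edge closing) ≡ 0ℚ
      path-zero = ∑-closed {P = _≡ 0ℚ} refl (λ { refl refl → refl })
                    (All.map (λ ≢closing → if-no (edge closing ≟E _) (≢closing ∘ sym)) fresh)

    g-closing≢0 : g (edge closing) ≢ 0ℚ
    g-closing≢0 = subst (λ q → ε * q ≢ 0ℚ) (sym flow-closing) (0<p⇒p*u≢0 ε-pos (sign² (proj₂ closing)))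

  cycle⇒¬basic : (∀ i → sizeE-item I i ≡ 1) → Cycle → ¬ Basic I δ x
  cycle⇒¬basic unit-items C =
    circulation⇒¬basic unit-items g-circulation g-within (edge (Cycle.closing C)) g-closing≢0
    where open Perturbation C

theorem3 : (I : Instance) (δ : ℕ) →
    (∀ (i : Fin (Instance.n I)) → sizeE-item I i ≡ 1) →
    (x : Edge I → ℚ) → Basic I δ x → Optimal I δ x → Integral I x
theorem3 I δ unit-items x basic _ e = decide (fractional? e)
  where
  open Solution I δ (proj₁ basic)
  decide : Dec (Fractional e) → x e ≡ 0ℚ ⊎ x e ≡ 1ℚ
  decide (no ¬frac) = ¬fractional⇒0∨1 e ¬frac
  decide (yes frac) = ⊥-elim (cycle⇒¬basic unit-items (cycle frac) basic)
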